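{- Let $G=(V,E)$ be a graph and let $E_M=\{e_1,\dots,e_d\}\subseteq E$ be a matching (no two edges of $E_M$ share an endpoint). Let $G'=(V,E\setminus E_M)$. Then for every vertex $w\in V$, $core_{G'}(w)\ge core_G(w)-1$, i.e. the core number of every vertex decreases by at most $1$.
   Context: All graphs are finite, simple and undirected. For an integer $k$, a $k$-core of a graph $G$ is a connected subgraph $H$ of $G$ in which every vertex has at least $k$ neighbours in $H$. The core number $core_G(u)$ of a vertex $u$ is the largest $k$ such that some $k$-core of $G$ contains $u$. A matching is a set of edges no two of which share an endpoint. -}

module Defs where

open import Data.Nat using (ℕ; _≤_)
open import Data.Fin using (Fin)
open import Data.Bool using (Bool; true; false; _∧_; not)
open import Data.Bool.Properties using (∧-comm)
open import Data.List using (List; length)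
open import Data.List.Relation.Unary.All using (All)
open import Data.List.Relation.Unary.Unique.Propositional using (Unique)
open import Data.Product using (Σ; _×_)
open import Relation.Binary.PropositionalEquality using (_≡_; refl; cong₂)

record Graph (n : ℕ) : Set where
  field
    Adj   : Fin n → Fin n → Bool
    sym   : ∀ i j → Adj i j ≡ Adj j i
    irrefl : ∀ i → Adj i i ≡ false
open Graph public

Edge : ∀ {n} → Graph n → Fin n → Fin n → Set
Edge G i j = Adj G i j ≡ true

record Matching {n : ℕ} (G : Graph n) : Set where
  field
    M      : Fin n → Fin n → Bool
    M-sym  : ∀ i j → M i j ≡ M j i
    M-sub  : ∀ i j → M i j ≡ true → Edge G i j
    M-disj : ∀ u v w → M u v ≡ true → M u w ≡ true → v ≡ w
open Matching public

_∖_ : ∀ {n} (G : Graph n) → Matching G → Graph n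
G ∖ Mt = record
  { Adj = λ i j → Adj G i j ∧ not (M Mt i j)
  ; sym = λ i j → cong₂ (λ a b → a ∧ not b) (Graph.sym G i j) (M-sym Mt i j)
  ; irrefl = λ i → irr i
  }
  where
  irr : ∀ i → Adj G i i ∧ not (M Mt i i) ≡ false
  irr i rewrite Graph.irrefl G i = refl

record Subgraph {n : ℕ} (G : Graph n) : Set₁ where
  field
    V     : Fin n → Set
    E     : Fin n → Fin n → Set
    E-sub : ∀ {i j} → E i j → Edge G i j
    E-sym : ∀ {i j} → E i j → E j i
    E-V   : ∀ {i j} → E i j → V i × V j
open Subgraph public

data Walk {n : ℕ} {G : Graph n} (H : Subgraph G) : Fin n → Fin n → Set where
  here : ∀ {u} → V H u → Walk H u u
  step : ∀ {u v w} → E H u v → Walk H v w → Walk H u w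

Connected : ∀ {n} {G : Graph n} → Subgraph G → Set
Connected H = ∀ u v → V H u → V H v → Walk H u v

DegAtLeast : ∀ {n} {G : Graph n} → Subgraph G → Fin n → ℕ → Set
DegAtLeast H v k =
  Σ (List _) λ xs → Unique xs × All (E H v) xs × k ≤ length xs

IsKCore : ∀ {n} {G : Graph n} → ℕ → Subgraph G → Set
IsKCore k H = Connected H × (∀ v → V H v → DegAtLeast H v k)

InKCore : ∀ {n} → Graph n → ℕ → Fin n → Set₁
InKCore G k u = Σ (Subgraph G) λ H → IsKCore k H × V H u

IsCoreNumber : ∀ {n} → Graph n → Fin n → ℕ → Set₁
IsCoreNumber G u c = InKCore G c u × (∀ k → InKCore G k u → k ≤ c)

-- Removing a matching from a k-core H deletes at most one edge at each vertex, so in what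
-- remains of H every vertex keeps k - 1 neighbours. The connected component of w in this
-- remainder is therefore a (k - 1)-core of G ∖ E_M containing w.
module Submission where

open import Defs
open import Data.Nat using (ℕ; suc; _≤_; _∸_; z≤n; s≤s)
open import Data.Nat.Properties using (≤-reflexive; ≤-trans; ∸-monoˡ-≤)
open import Data.Fin using (Fin)
open import Data.Bool using (false)
open import Data.Bool.Properties using (¬-not) renaming (_≟_ to _≟ᵇ_)
open import Data.List using ([]; _∷_; length; filter)
open import Data.List.Properties using (filter-all)
import Data.List.Relation.Unary.All as All
open import Data.List.Relation.Unary.All.Properties using (all-filter; filter⁺)
open import Data.List.Relation.Unary.AllPairs using ([]; _∷_)
open import Data.List.Relation.Unary.Unique.Propositional using (Unique)
import Data.List.Relation.Unary.Unique.Propositional.Properties as Unique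
open import Data.Product using (_×_; _,_; proj₂)
open import Relation.Nullary using (¬_; yes; no)
open import Relation.Nullary.Decidable using (decidable-stable)
open import Relation.Unary using (Pred; Decidable)
open import Relation.Binary.PropositionalEquality using (_≡_; refl; trans; cong)
import Relation.Binary.PropositionalEquality as ≡

module _ {a p} {A : Set a} {P : Pred A p} (P? : Decidable P) where

  length≤suc-length-filter : (∀ {x y} → ¬ P x → ¬ P y → x ≡ y) →
    ∀ {xs} → Unique xs → length xs ≤ suc (length (filter P? xs))
  length≤suc-length-filter atMostOneFails {[]} [] = z≤n
  length≤suc-length-filter atMostOneFails {x ∷ xs} (x∉xs ∷ !xs) with P? x
  ... | yes _ = s≤s (length≤suc-length-filter atMostOneFails !xs)
  ... | no ¬Px = s≤s (≤-reflexive (cong length (≡.sym (filter-all P? (All.map keep x∉xs)))))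
    where
    keep : ∀ {y} → ¬ x ≡ y → P y
    keep x≢y = decidable-stable (P? _) (λ ¬Py → x≢y (atMostOneFails ¬Px ¬Py))

module _ {n : ℕ} {G : Graph n} {K : Subgraph G} where

  _++ʷ_ : ∀ {u v x} → Walk K u v → Walk K v x → Walk K u x
  here _   ++ʷ q = q
  step e p ++ʷ q = step e (p ++ʷ q)

  target : ∀ {u v} → Walk K u v → V K v
  target (here v∈K) = v∈K
  target (step _ p) = target p

  extend : ∀ {u v x} → Walk K u v → E K v x → Walk K u x
  extend p e = p ++ʷ step e (here (proj₂ (E-V K e)))

  reverse : ∀ {u v} → Walk K u v → Walk K v u
  reverse (here u∈K) = here u∈K
  reverse (step e p) = extend (reverse p) (E-sym K e)

component : ∀ {n} {G : Graph n} → Subgraph G → Fin n → Subgraph G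
component K w = record
  { V     = Walk K w
  ; E     = λ i j → E K i j × Walk K w i
  ; E-sub = λ (e , _) → E-sub K e
  ; E-sym = λ (e , p) → E-sym K e , extend p e
  ; E-V   = λ (e , p) → p , extend p e
  }

module _ {n : ℕ} {G : Graph n} {K : Subgraph G} {w : Fin n} where

  walk-in-component : ∀ {u v} → Walk K w u → Walk K u v → Walk (component K w) u v
  walk-in-component p (here _)   = here p
  walk-in-component p (step e q) = step (e , p) (walk-in-component (extend p e) q)

  component-connected : Connected (component K w)
  component-connected u v p q = walk-in-component p (reverse p ++ʷ q)

  component-isKCore : ∀ {k} → (∀ v → V K v → DegAtLeast K v k) → IsKCore k (component K w)
  component-isKCore deg =
    component-connected ,
    λ v p → let xs , !xs , adj , k≤ = deg v (target p) in xs , !xs , All.map (_, p) adj , k≤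

module _ {n : ℕ} {G : Graph n} (EM : Matching G) where

  Unmatched : Fin n → Fin n → Set
  Unmatched i j = M EM i j ≡ false

  Unmatched? : ∀ i → Decidable (Unmatched i)
  Unmatched? i j = M EM i j ≟ᵇ false

  edge-∖ : ∀ {i j} → Edge G i j → Unmatched i j → Edge (G ∖ EM) i j
  edge-∖ e m rewrite e | m = refl

_∖ˢ_ : ∀ {n} {G : Graph n} → Subgraph G → (EM : Matching G) → Subgraph (G ∖ EM)
H ∖ˢ EM = record
  { V     = V H
  ; E     = λ i j → E H i j × Unmatched EM i j
  ; E-sub = λ (e , m) → edge-∖ EM (E-sub H e) m
  ; E-sym = λ {i} {j} (e , m) → E-sym H e , trans (M-sym EM j i) m
  ; E-V   = λ (e , _) → E-V H e
  }

∖ˢ-degree : ∀ {n} {G : Graph n} (EM : Matching G) {H : Subgraph G} {v k} →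
  DegAtLeast H v k → DegAtLeast (H ∖ˢ EM) v (k ∸ 1)
∖ˢ-degree EM {v = v} (xs , !xs , adj , k≤) =
  filter (Unmatched? EM v) xs ,
  Unique.filter⁺ (Unmatched? EM v) !xs ,
  All.zip (filter⁺ (Unmatched? EM v) adj , all-filter (Unmatched? EM v) xs) ,
  ≤-trans (∸-monoˡ-≤ 1 k≤)
          (∸-monoˡ-≤ 1 (length≤suc-length-filter (Unmatched? EM v) matched-unique !xs))
  where
  matched-unique : ∀ {x y} → ¬ Unmatched EM v x → ¬ Unmatched EM v y → x ≡ y
  matched-unique {x} {y} vx∈M vy∈M = M-disj EM v x y (¬-not vx∈M) (¬-not vy∈M)

lemma5 : (n : ℕ) (G : Graph n) (EM : Matching G) (w : Fin n) (a b : ℕ) →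
    IsCoreNumber G w a → IsCoreNumber (G ∖ EM) w b → a ∸ 1 ≤ b
lemma5 n G EM w a b ((H , (_ , degH) , w∈H) , _) (_ , maximal) =
  maximal (a ∸ 1)
    ( component (H ∖ˢ EM) w
    , component-isKCore (λ v v∈H → ∖ˢ-degree EM {H} (degH v v∈H))
    , here w∈H )
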